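{- Let $T$ be a finite tree. Then \[\nu(T)=|\operatorname{Core}(T)|+\frac{v(\mathcal{F}_{N}(T))}{2},\qquad \alpha(T)=|\operatorname{Supp}(T)|+\frac{v(\mathcal{F}_{N}(T))}{2}.\]
   Context: $\nu(T)$ is the matching number and $\alpha(T)$ the independence number of $T$. $\mathcal{N}(T)$ is the null space of the adjacency matrix of $T$; $\operatorname{Supp}(T)=\{v\in V(T): x_v\neq0\text{ for some }x\in\mathcal{N}(T)\}$; $\operatorname{Core}(T)=N(\operatorname{Supp}(T))=\bigcup_{u\in\operatorname{Supp}(T)}N(u)$, where $N(u)$ is the set of neighbours of $u$. $\mathcal{F}_{N}(T)$ is the forest obtained from $T$ by deleting all vertices of $N[\operatorname{Supp}(T)]=\operatorname{Supp}(T)\cup\operatorname{Core}(T)$, and $v(\mathcal{F}_{N}(T))$ is its number of vertices. -}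

module Defs where

open import Data.Nat using (ℕ; zero; suc; _≤_)
open import Data.Unit using (⊤)
open import Data.Bool using (Bool; true; false; T; if_then_else_)
open import Data.Fin using (Fin; zero; suc)
open import Data.Fin.Subset using (Subset; _∈_; ∣_∣)
open import Data.List using (List; []; _∷_; _++_; [_]; length; concatMap)
open import Data.List.Relation.Unary.All using (All)
open import Data.List.Relation.Unary.Unique.Propositional using (Unique)
open import Data.Product using (Σ; ∃; _×_; _,_; proj₁; proj₂)
open import Data.Rational using (ℚ; 0ℚ; 1ℚ; _+_; _*_)
open import Relation.Nullary using (¬_)
open import Relation.Binary.PropositionalEquality using (_≡_; _≢_)

record Graph (n : ℕ) : Set where
  field
    adj     : Fin n → Fin n → Bool
    sym     : ∀ u v → adj u v ≡ adj v u
    irrefl  : ∀ v → adj v v ≡ false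

module _ {n : ℕ} (G : Graph n) where
  open Graph G

  Adj : Fin n → Fin n → Set
  Adj u v = T (adj u v)

  data Reach : Fin n → Fin n → Set where
    here : ∀ {v} → Reach v v
    step : ∀ {u w v} → Adj u w → Reach w v → Reach u v

  Connected : Set
  Connected = ∀ u v → Reach u v

  Chain : List (Fin n) → Set
  Chain []           = ⊤
  Chain (x ∷ [])     = ⊤
  Chain (x ∷ y ∷ xs) = Adj x y × Chain (y ∷ xs)

  IsCycle : Fin n → List (Fin n) → Set
  IsCycle v0 vs = Unique (v0 ∷ vs) × (2 ≤ length vs) × Chain (v0 ∷ vs ++ [ v0 ])

  Acyclic : Set
  Acyclic = ∀ v0 vs → ¬ IsCycle v0 vs

  IsTree : Set
  IsTree = (1 ≤ n) × Connected × Acyclic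

  endpoints : List (Fin n × Fin n) → List (Fin n)
  endpoints = concatMap (λ e → proj₁ e ∷ proj₂ e ∷ [])

  IsMatching : List (Fin n × Fin n) → Set
  IsMatching M = All (λ e → Adj (proj₁ e) (proj₂ e)) M × Unique (endpoints M)

  IsMatchingNumber : ℕ → Set
  IsMatchingNumber k =
    (Σ (List (Fin n × Fin n)) λ M → IsMatching M × length M ≡ k) ×
    (∀ M → IsMatching M → length M ≤ k)

  IsIndependent : Subset n → Set
  IsIndependent I = ∀ u v → u ∈ I → v ∈ I → ¬ Adj u v

  IsIndependenceNumber : ℕ → Set
  IsIndependenceNumber k =
    (Σ (Subset n) λ I → IsIndependent I × ∣ I ∣ ≡ k) ×
    (∀ I → IsIndependent I → ∣ I ∣ ≤ k)

  A : Fin n → Fin n → ℚ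
  A u v = if adj u v then 1ℚ else 0ℚ

  sumℚ : ∀ {m} → (Fin m → ℚ) → ℚ
  sumℚ {zero}  f = 0ℚ
  sumℚ {suc m} f = f zero + sumℚ (λ i → f (suc i))

  InNullSpace : (Fin n → ℚ) → Set
  InNullSpace x = ∀ v → sumℚ (λ u → A v u * x u) ≡ 0ℚ

  InSupp : Fin n → Set
  InSupp v = Σ (Fin n → ℚ) λ x → InNullSpace x × x v ≢ 0ℚ

  InCore : Fin n → Set
  InCore v = Σ (Fin n) λ u → InSupp u × Adj u v

module Submission where

-- Root T and layer it by depth.  We prove the identities for every
-- induced subgraph G[W] by induction on |W|, tracking the support of G[W]
-- (computed from that of a smaller subgraph) together with ν and α.  Let ℓ be
-- a deepest vertex of W.
--   * If ℓ has no neighbour in W, then ℓ ∈ Supp, ν is unchanged and α grows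
--     by one (module Isolated).
--   * Otherwise its neighbour p in W is its parent and ℓ's only neighbour.
--     Removing ℓ and p: every null vector vanishes at p, ℓ ∈ Supp(G[W]) iff p
--     has a neighbour in Supp(G[W ∖ {ℓ,p}]) (and then p joins the core),
--     otherwise ℓ and p join F_N; ν and α both grow by one (module Pendant).

open import Defs
open import Data.Nat using (ℕ; zero; suc; _+_; _*_; _≤_; _<_; z≤n; s≤s; _≤′_; ≤′-reflexive; ≤′-step)
import Data.Nat.Properties as ℕₚ
open import Data.Nat.Tactic.RingSolver using (solve-∀)
open import Data.Bool using (Bool; true; false; _∧_; _∨_; not; T)
open import Data.Bool.Properties using (¬-not; ∨-zeroʳ)
import Data.Bool.Properties as Boolₚ
open import Algebra.Lattice.Properties.BooleanAlgebra Boolₚ.∨-∧-booleanAlgebra using (deMorgan₂)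
open import Data.Fin using (Fin; zero; suc)
open import Data.Fin.Properties using (_≟_; suc-injective; any?)
open import Data.Fin.Subset using (Subset; _∈_; ∣_∣; _∪_; ∁)
open import Data.Vec using (lookup; tabulate) renaming ([] to []ᵥ; _∷_ to _∷ᵥ_)
import Data.Vec.Properties as Vecₚ
open import Data.List using (List; []; _∷_; _++_; [_]; length)
open import Data.List.Relation.Unary.All using (All; []; _∷_)
import Data.List.Relation.Unary.All as All
import Data.List.Relation.Unary.All.Properties as Allₚ
open import Data.List.Relation.Unary.AllPairs using ([]; _∷_)
open import Data.List.Relation.Unary.Unique.Propositional using (Unique)
open import Data.Product using (Σ; ∃; ∃-syntax; _×_; _,_; proj₁; proj₂)
open import Data.Sum using (_⊎_; inj₁; inj₂)
open import Data.Unit using (tt)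
open import Data.Empty using (⊥; ⊥-elim)
open import Data.Rational using (ℚ; 0ℚ; 1ℚ) renaming (_+_ to _+ℚ_; _*_ to _*ℚ_; -_ to -ℚ_)
import Data.Rational.Properties as ℚₚ
open import Function using (_∘_)
open import Function.Bundles using (_⇔_; mk⇔; Equivalence)
open import Relation.Nullary using (¬_; Dec; yes; no; does)
open import Relation.Nullary.Decidable using (T?; dec-true; _⊎-dec_; _×-dec_)
open import Relation.Binary.PropositionalEquality
  using (_≡_; _≢_; refl; sym; trans; cong; cong₂; subst; module ≡-Reasoning)

bool-ext : ∀ {b c : Bool} → (b ≡ true → c ≡ true) → (c ≡ true → b ≡ true) → b ≡ c
bool-ext {true}  b⇒c c⇒b = sym (b⇒c refl)
bool-ext {false} {true} b⇒c c⇒b = c⇒b refl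
bool-ext {false} {false} b⇒c c⇒b = refl

≡true⇒T : ∀ {b} → b ≡ true → T b
≡true⇒T refl = _

T⇒≡true : ∀ {b} → T b → b ≡ true
T⇒≡true {true} _ = refl

true≢false : true ≢ false
true≢false ()

bool-cases : ∀ {P : Set} (b : Bool) → (b ≡ true → P) → (b ≡ false → P) → P
bool-cases true  if-true if-false = if-true refl
bool-cases false if-true if-false = if-false refl

∧-guard : ∀ {a a' b b'} → a ≡ a' → (a ≡ true → b ≡ b') → a ∧ b ≡ a' ∧ b'
∧-guard {true}  refl b≡b' = cong (true ∧_) (b≡b' refl)
∧-guard {false} refl b≡b' = refl

∧-false : ∀ a {b} → b ≡ false → a ∧ b ≡ false
∧-false a refl = Boolₚ.∧-zeroʳ a

ind : Bool → ℕ
ind true  = 1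
ind false = 0

count : ∀ {m} → (Fin m → Bool) → ℕ
count {zero}  f = 0
count {suc m} f = ind (f zero) + count (λ i → f (suc i))

ind≤1 : ∀ b → ind b ≤ 1
ind≤1 true  = s≤s z≤n
ind≤1 false = z≤n

at-most-one : ∀ a b → (a ≡ true → b ≡ true → ⊥) → ind a + ind b ≤ 1
at-most-one true  true  not-both = ⊥-elim (not-both refl refl)
at-most-one true  false _        = s≤s z≤n
at-most-one false b     _        = ind≤1 b

count-ext : ∀ {m} {f g : Fin m → Bool} → (∀ v → f v ≡ g v) → count f ≡ count g
count-ext {zero}  eq = refl
count-ext {suc m} eq = cong₂ _+_ (cong ind (eq zero)) (count-ext (λ i → eq (suc i)))

count-none : ∀ {m} {f : Fin m → Bool} → (∀ v → f v ≡ false) → count f ≡ 0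
count-none {zero}  none = refl
count-none {suc m} none rewrite none zero = count-none (λ i → none (suc i))

count-point : ∀ {m} (f g : Fin m → Bool) (w : Fin m) → (∀ v → v ≢ w → f v ≡ g v) →
              count f + ind (g w) ≡ count g + ind (f w)
count-point {suc m} f g zero agree
  rewrite count-ext {f = λ i → f (suc i)} {g = λ i → g (suc i)} (λ i → agree (suc i) λ ())
  = swap (ind (f zero)) (ind (g zero)) (count (λ i → g (suc i)))
  where
  swap : ∀ a b c → a + c + b ≡ b + c + a
  swap = solve-∀
count-point {suc m} f g (suc w) agree rewrite agree zero (λ ()) =
  begin
    ind (g zero) + count f' + ind (g (suc w))   ≡⟨ ℕₚ.+-assoc (ind (g zero)) _ _ ⟩
    ind (g zero) + (count f' + ind (g (suc w))) ≡⟨ cong (ind (g zero) +_) tail ⟩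
    ind (g zero) + (count g' + ind (f (suc w))) ≡⟨ ℕₚ.+-assoc (ind (g zero)) _ _ ⟨
    ind (g zero) + count g' + ind (f (suc w))   ∎
  where
  open ≡-Reasoning
  f' g' : Fin _ → Bool
  f' i = f (suc i)
  g' i = g (suc i)
  tail = count-point f' g' w (λ v v≢w → agree (suc v) (λ eq → v≢w (suc-injective eq)))

maximise : ∀ {m} (f : Fin m → Bool) (g : Fin m → ℕ) →
           (∀ v → f v ≡ false) ⊎ ∃ λ best → f best ≡ true × (∀ v → f v ≡ true → g v ≤ g best)
maximise {zero}  f g = inj₁ λ ()
maximise {suc m} f g with maximise (λ i → f (suc i)) (λ i → g (suc i)) | f zero in f0
... | inj₁ none               | false = inj₁ λ { zero → f0 ; (suc v) → none v }
... | inj₁ none               | true  = inj₂ (zero , f0 , λ { zero _ → ℕₚ.≤-refl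
                                                          ; (suc v) fv → ⊥-elim (true≢false (trans (sym fv) (none v))) })
... | inj₂ (best , fb , max)  | false = inj₂ (suc best , fb , λ { zero f0' → ⊥-elim (true≢false (trans (sym f0') f0))
                                                              ; (suc v) fv → max v fv })
... | inj₂ (best , fb , max)  | true with g zero ℕₚ.≤? g (suc best)
...   | yes g0≤ = inj₂ (suc best , fb , λ { zero _ → g0≤ ; (suc v) fv → max v fv })
...   | no  g0≰ = inj₂ (zero , f0 , λ { zero _ → ℕₚ.≤-refl
                                      ; (suc v) fv → ℕₚ.≤-trans (max v fv) (ℕₚ.<⇒≤ (ℕₚ.≰⇒> g0≰)) })

anyᵇ : ∀ {m} → (Fin m → Bool) → Bool
anyᵇ f = does (any? (λ i → T? (f i)))

anyᵇ-intro : ∀ {m} {f : Fin m → Bool} v → f v ≡ true → anyᵇ f ≡ true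
anyᵇ-intro v fv = dec-true (any? _) (v , ≡true⇒T fv)

anyᵇ-elim : ∀ {m} {f : Fin m → Bool} → anyᵇ f ≡ true → ∃ λ v → f v ≡ true
anyᵇ-elim {f = f} any≡true with any? (λ i → T? (f i))
... | yes (v , fv) = v , T⇒≡true fv

anyᵇ-none : ∀ {m} {f : Fin m → Bool} → (∀ v → f v ≡ false) → anyᵇ f ≡ false
anyᵇ-none none = ¬-not λ any≡true → let v , fv = anyᵇ-elim any≡true in true≢false (trans (sym fv) (none v))

anyᵇ-ext : ∀ {m} {f g : Fin m → Bool} → (∀ v → f v ≡ g v) → anyᵇ f ≡ anyᵇ g
anyᵇ-ext f≈g = bool-ext (λ e → let v , fv = anyᵇ-elim e in anyᵇ-intro v (trans (sym (f≈g v)) fv))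
                        (λ e → let v , gv = anyᵇ-elim e in anyᵇ-intro v (trans (f≈g v) gv))

module _ {n : ℕ} where

  update : {A : Set} → Fin n → A → (Fin n → A) → Fin n → A
  update w b f v with v ≟ w
  ... | yes _ = b
  ... | no  _ = f v

  update-same : ∀ {A : Set} w (b : A) f → update w b f w ≡ b
  update-same w b f with w ≟ w
  ... | yes _   = refl
  ... | no  w≢w = ⊥-elim (w≢w refl)

  update-other : ∀ {A : Set} {w v} (b : A) f → v ≢ w → update w b f v ≡ f v
  update-other {w = w} {v} b f v≢w with v ≟ w
  ... | yes v≡w = ⊥-elim (v≢w v≡w)
  ... | no  _   = refl

  by-cases : ∀ {P : Set} (v w : Fin n) → (v ≡ w → P) → (v ≢ w → P) → P
  by-cases v w same different with v ≟ w
  ... | yes v≡w = same v≡w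
  ... | no  v≢w = different v≢w

  count-update : ∀ (f : Fin n → Bool) w b → count (update w b f) + ind (f w) ≡ count f + ind b
  count-update f w b =
    trans (count-point (update w b f) f w (λ v v≢w → update-other b f v≢w))
          (cong (λ x → count f + ind x) (update-same w b f))

  count-insert : ∀ (f : Fin n → Bool) w → f w ≡ false → count (update w true f) ≡ suc (count f)
  count-insert f w fw≡false = begin
    count (update w true f)                ≡⟨ ℕₚ.+-identityʳ _ ⟨
    count (update w true f) + 0            ≡⟨ cong (λ x → count (update w true f) + ind x) fw≡false ⟨
    count (update w true f) + ind (f w)    ≡⟨ count-update f w true ⟩
    count f + 1                            ≡⟨ ℕₚ.+-comm (count f) 1 ⟩
    suc (count f)                          ∎
    where open ≡-Reasoning

  count-remove : ∀ (f : Fin n → Bool) w → count f ≡ count (update w false f) + ind (f w)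
  count-remove f w = trans (sym (ℕₚ.+-identityʳ (count f))) (sym (count-update f w false))

  count-off-one : ∀ {f g : Fin n → Bool} a → (∀ v → v ≢ a → f v ≡ g v) → g a ≡ false →
                  count f ≡ count g + ind (f a)
  count-off-one {f} {g} a agree ga≡false = begin
    count f                ≡⟨ ℕₚ.+-identityʳ _ ⟨
    count f + 0            ≡⟨ cong (λ x → count f + ind x) ga≡false ⟨
    count f + ind (g a)    ≡⟨ count-point f g a agree ⟩
    count g + ind (f a)    ∎
    where open ≡-Reasoning

  count-off-two : ∀ {f g : Fin n → Bool} a b → a ≢ b → (∀ v → v ≢ a → v ≢ b → f v ≡ g v) →
                  g a ≡ false → g b ≡ false → count f ≡ count g + ind (f a) + ind (f b)
  count-off-two {f} {g} a b a≢b agree ga≡false gb≡false =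
    trans (count-off-one b f≈h (trans (update-other (f a) g (λ b≡a → a≢b (sym b≡a))) gb≡false))
          (cong (_+ ind (f b)) (trans (count-off-one a h≈g ga≡false)
                                      (cong (λ x → count g + ind x) (update-same a (f a) g))))
    where
    h : Fin n → Bool
    h = update a (f a) g
    f≈h : ∀ v → v ≢ b → f v ≡ h v
    f≈h v v≢b = by-cases v a (λ { refl → sym (update-same a (f a) g) })
                             (λ v≢a → trans (agree v v≢a v≢b) (sym (update-other (f a) g v≢a)))
    h≈g : ∀ v → v ≢ a → h v ≡ g v
    h≈g v v≢a = update-other (f a) g v≢a

module Basics {n : ℕ} (G : Graph n) where
  open Graph G using (adj)

  Adj-sym : ∀ {u v} → Adj G u v → Adj G v u
  Adj-sym {u} {v} = subst T (Graph.sym G u v)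

  Adj-irrefl : ∀ {u} → ¬ Adj G u u
  Adj-irrefl {u} = subst T (Graph.irrefl G u)

  Adj⇒adj : ∀ {u v} → Adj G u v → adj u v ≡ true
  Adj⇒adj {u} {v} a with adj u v
  ... | true = refl

  adj⇒Adj : ∀ {u v} → adj u v ≡ true → Adj G u v
  adj⇒Adj eq = subst T (sym eq) _

  adj-sym : ∀ u v → adj u v ≡ adj v u
  adj-sym = Graph.sym G

  sum-ext : ∀ {m} {f g : Fin m → ℚ} → (∀ u → f u ≡ g u) → sumℚ G f ≡ sumℚ G g
  sum-ext {zero}  eq = refl
  sum-ext {suc m} eq = cong₂ _+ℚ_ (eq zero) (sum-ext (λ i → eq (suc i)))

  sum-zero : ∀ {m} (f : Fin m → ℚ) → (∀ u → f u ≡ 0ℚ) → sumℚ G f ≡ 0ℚ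
  sum-zero {zero}  f zeros = refl
  sum-zero {suc m} f zeros =
    trans (cong₂ _+ℚ_ (zeros zero) (sum-zero (λ i → f (suc i)) (λ i → zeros (suc i)))) (ℚₚ.+-identityˡ 0ℚ)

  sum-point : ∀ {m} (f g : Fin m → ℚ) w → (∀ u → u ≢ w → f u ≡ g u) → sumℚ G f +ℚ g w ≡ sumℚ G g +ℚ f w
  sum-point {suc m} f g zero agree
    rewrite sum-ext {f = λ i → f (suc i)} {g = λ i → g (suc i)} (λ i → agree (suc i) (λ ()))
    = swap (f zero) (g zero) (sumℚ G (λ i → g (suc i)))
    where
    swap : ∀ a b c → (a +ℚ c) +ℚ b ≡ (b +ℚ c) +ℚ a
    swap a b c = trans (ℚₚ.+-comm (a +ℚ c) b)
                       (trans (cong (b +ℚ_) (ℚₚ.+-comm a c)) (sym (ℚₚ.+-assoc b c a)))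
  sum-point {suc m} f g (suc w) agree rewrite agree zero (λ ()) =
    trans (ℚₚ.+-assoc (g zero) _ _)
      (trans (cong (g zero +ℚ_) (sum-point (λ i → f (suc i)) (λ i → g (suc i)) w
                                   (λ u u≢w → agree (suc u) (λ eq → u≢w (suc-injective eq)))))
        (sym (ℚₚ.+-assoc (g zero) _ _)))

  sum-single : ∀ {m} (f : Fin m → ℚ) w → (∀ u → u ≢ w → f u ≡ 0ℚ) → sumℚ G f ≡ f w
  sum-single {m} f w zeros = begin
    sumℚ G f                          ≡⟨ ℚₚ.+-identityʳ _ ⟨
    sumℚ G f +ℚ 0ℚ                    ≡⟨ sum-point f (λ _ → 0ℚ) w zeros ⟩
    sumℚ G (λ (_ : Fin m) → 0ℚ) +ℚ f w ≡⟨ cong (_+ℚ f w) (sum-zero {m} (λ _ → 0ℚ) (λ _ → refl)) ⟩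
    0ℚ +ℚ f w                         ≡⟨ ℚₚ.+-identityˡ _ ⟩
    f w                               ∎
    where open ≡-Reasoning

  sum-nonzero : ∀ {m} (f : Fin m → ℚ) → sumℚ G f ≢ 0ℚ → ∃ λ u → f u ≢ 0ℚ
  sum-nonzero {zero}  f sum≢0 = ⊥-elim (sum≢0 refl)
  sum-nonzero {suc m} f sum≢0 with f zero ℚₚ.≟ 0ℚ
  ... | no  f0≢0 = zero , f0≢0
  ... | yes f0≡0 with sum-nonzero (λ i → f (suc i))
                        (λ rest≡0 → sum≢0 (trans (cong₂ _+ℚ_ f0≡0 rest≡0) (ℚₚ.+-identityˡ 0ℚ)))
  ...   | u , fu≢0 = suc u , fu≢0

  A-nonadj : ∀ {v u} c → adj v u ≡ false → A G v u *ℚ c ≡ 0ℚ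
  A-nonadj {v} {u} c eq rewrite eq = ℚₚ.*-zeroˡ c

  A-adj : ∀ {v u} c → adj v u ≡ true → A G v u *ℚ c ≡ c
  A-adj {v} {u} c eq rewrite eq = ℚₚ.*-identityˡ c

  A-zero : ∀ {v u} {c} → c ≡ 0ℚ → A G v u *ℚ c ≡ 0ℚ
  A-zero {v} {u} refl = ℚₚ.*-zeroʳ (A G v u)

  rowSum : Fin n → (Fin n → ℚ) → ℚ
  rowSum v x = sumℚ G (λ u → A G v u *ℚ x u)

  rowSum-agree : ∀ {v w} {x y : Fin n → ℚ} → (∀ u → u ≢ w → x u ≡ y u) → adj v w ≡ false →
                 rowSum v x ≡ rowSum v y
  rowSum-agree {v} {w} {x} {y} agree v≁w = begin
    rowSum v x                       ≡⟨ ℚₚ.+-identityʳ _ ⟨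
    rowSum v x +ℚ 0ℚ                 ≡⟨ cong (rowSum v x +ℚ_) (A-nonadj (y w) v≁w) ⟨
    rowSum v x +ℚ A G v w *ℚ y w     ≡⟨ sum-point _ _ w (λ u u≢w → cong (A G v u *ℚ_) (agree u u≢w)) ⟩
    rowSum v y +ℚ A G v w *ℚ x w     ≡⟨ cong (rowSum v y +ℚ_) (A-nonadj (x w) v≁w) ⟩
    rowSum v y +ℚ 0ℚ                 ≡⟨ ℚₚ.+-identityʳ _ ⟩
    rowSum v y                       ∎
    where open ≡-Reasoning

  rowSum-update : ∀ {v w} (c : ℚ) (x : Fin n → ℚ) → adj v w ≡ true →
                  rowSum v x +ℚ c ≡ rowSum v (update w c x) +ℚ x w
  rowSum-update {v} {w} c x v∼w = begin
    rowSum v x +ℚ c                                  ≡⟨ cong (rowSum v x +ℚ_) (trans (cong (A G v w *ℚ_) (update-same w c x)) (A-adj c v∼w)) ⟨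
    rowSum v x +ℚ A G v w *ℚ update w c x w          ≡⟨ sum-point _ _ w (λ u u≢w → cong (A G v u *ℚ_) (sym (update-other c x u≢w))) ⟩
    rowSum v (update w c x) +ℚ A G v w *ℚ x w        ≡⟨ cong (rowSum v (update w c x) +ℚ_) (A-adj (x w) v∼w) ⟩
    rowSum v (update w c x) +ℚ x w                   ∎
    where open ≡-Reasoning

  rowSum-single : ∀ {v w} (x : Fin n → ℚ) → (∀ u → u ≢ w → A G v u *ℚ x u ≡ 0ℚ) → adj v w ≡ true →
                  rowSum v x ≡ x w
  rowSum-single {v} {w} x zeros v∼w = trans (sum-single _ w zeros) (A-adj (x w) v∼w)

  unit : Fin n → Fin n → ℚ
  unit w = update w 1ℚ (λ _ → 0ℚ)

  unit-off : ∀ {w u} → u ≢ w → unit w u ≡ 0ℚ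
  unit-off = update-other 1ℚ _

  rowSum-unit-adj : ∀ {v w} → adj v w ≡ true → rowSum v (unit w) ≡ 1ℚ
  rowSum-unit-adj {v} {w} v∼w =
    trans (rowSum-single (unit w) (λ u u≢w → A-zero (unit-off u≢w)) v∼w) (update-same w 1ℚ _)

  rowSum-unit-nonadj : ∀ {v w} → adj v w ≡ false → rowSum v (unit w) ≡ 0ℚ
  rowSum-unit-nonadj {v} {w} v≁w =
    trans (sum-single _ w (λ u u≢w → A-zero (unit-off u≢w))) (A-nonadj _ v≁w)

  touches? : (p : Fin n) (e : Fin n × Fin n) → Dec ((proj₁ e ≡ p) ⊎ (proj₂ e ≡ p))
  touches? p (a , b) = (a ≟ p) ⊎-dec (b ≟ p)

  drop-at : Fin n → List (Fin n × Fin n) → List (Fin n × Fin n)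
  drop-at p []      = []
  drop-at p (e ∷ M) with touches? p e
  ... | yes _ = drop-at p M
  ... | no  _ = e ∷ drop-at p M

  drop-at-endpoints : ∀ {P : Fin n → Set} p M → All P (endpoints G M) → All P (endpoints G (drop-at p M))
  drop-at-endpoints p []            ps               = ps
  drop-at-endpoints p ((a , b) ∷ M) (pa ∷ pb ∷ ps) with touches? p (a , b)
  ... | yes _ = drop-at-endpoints p M ps
  ... | no  _ = pa ∷ pb ∷ drop-at-endpoints p M ps

  drop-at-avoids : ∀ p M → All (_≢ p) (endpoints G (drop-at p M))
  drop-at-avoids p []            = []
  drop-at-avoids p ((a , b) ∷ M) with touches? p (a , b)
  ... | yes _   = drop-at-avoids p M
  ... | no  ¬ab = (λ a≡p → ¬ab (inj₁ a≡p)) ∷ (λ b≡p → ¬ab (inj₂ b≡p)) ∷ drop-at-avoids p M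

  drop-at-matching : ∀ p M → IsMatching G M → IsMatching G (drop-at p M)
  drop-at-matching p []            matching = matching
  drop-at-matching p ((a , b) ∷ M) ((a∼b ∷ edges) , ((a∉ ∷ a∉M) ∷ (b∉M ∷ distinct))) with touches? p (a , b)
  ... | yes _ = drop-at-matching p M (edges , distinct)
  ... | no  _ = let edges' , distinct' = drop-at-matching p M (edges , distinct)
                in (a∼b ∷ edges') , ((a∉ ∷ drop-at-endpoints p M a∉M) ∷ (drop-at-endpoints p M b∉M ∷ distinct'))

  drop-at-nothing : ∀ p M → All (_≢ p) (endpoints G M) → length M ≤ length (drop-at p M)
  drop-at-nothing p []            _                = z≤n
  drop-at-nothing p ((a , b) ∷ M) (a≢p ∷ b≢p ∷ ps) with touches? p (a , b)
  ... | yes (inj₁ a≡p) = ⊥-elim (a≢p a≡p)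
  ... | yes (inj₂ b≡p) = ⊥-elim (b≢p b≡p)
  ... | no  _          = s≤s (drop-at-nothing p M ps)

  -- In a matching at most one edge is incident with p.
  drop-at-length : ∀ p M → Unique (endpoints G M) → length M ≤ suc (length (drop-at p M))
  drop-at-length p []            _                             = z≤n
  drop-at-length p ((a , b) ∷ M) ((_ ∷ a∉M) ∷ (b∉M ∷ distinct)) with touches? p (a , b)
  ... | yes (inj₁ refl) = s≤s (drop-at-nothing p M (All.map (λ a≢x x≡a → a≢x (sym x≡a)) a∉M))
  ... | yes (inj₂ refl) = s≤s (drop-at-nothing p M (All.map (λ b≢x x≡b → b≢x (sym x≡b)) b∉M))
  ... | no  _           = s≤s (drop-at-length p M distinct)

  chain-snoc : ∀ x xs y z → Chain G (x ∷ xs ++ [ y ]) → Adj G y z → Chain G (x ∷ (xs ++ [ y ]) ++ [ z ])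
  chain-snoc x []       y z (x∼y , _) y∼z = x∼y , y∼z , tt
  chain-snoc x (w ∷ ws) y z (x∼w , c) y∼z = x∼w , chain-snoc w ws y z c y∼z

  -- Rooting every component of a forest gives a layering by depth.
  record Layering : Set where
    field
      depth           : Fin n → ℕ
      adjacent-layers : ∀ {u v} → Adj G u v → (depth v ≡ suc (depth u)) ⊎ (depth u ≡ suc (depth v))
      unique-parent   : ∀ {u u' v} → Adj G u v → Adj G u' v →
                        depth v ≡ suc (depth u) → depth v ≡ suc (depth u') → u ≡ u'

unique-snoc : ∀ {A : Set} {xs : List A} {b : A} → Unique xs → All (_≢ b) xs → Unique (xs ++ [ b ])
unique-snoc []         []             = [] ∷ []
unique-snoc (x∉ ∷ uxs) (x≢b ∷ xs≢b) = Allₚ.++⁺ x∉ (x≢b ∷ []) ∷ unique-snoc uxs xs≢b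

1≤length-snoc : ∀ {A : Set} (xs : List A) (b : A) → 1 ≤ length (xs ++ [ b ])
1≤length-snoc []      b = s≤s z≤n
1≤length-snoc (_ ∷ _) b = s≤s z≤n

-- Breadth-first depth from a root turns a tree into a layered graph: two
-- adjacent vertices in the same layer, or two parents of one vertex, would
-- close a cycle through the (distinct) paths leading back towards the root.
module TreeDepth {n : ℕ} (G : Graph n) (root : Fin n) (connected : Connected G) (acyclic : Acyclic G) where
  open Graph G using (adj)
  open Basics G

  within : ℕ → Fin n → Bool
  within zero    v = does (v ≟ root)
  within (suc k) v = within k v ∨ anyᵇ (λ u → within k u ∧ adj u v)

  within-root : within 0 root ≡ true
  within-root = dec-true (root ≟ root) refl

  within-zero : ∀ {v} → within 0 v ≡ true → v ≡ root
  within-zero {v} w0 with v ≟ root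
  ... | yes v≡root = v≡root

  within-mono : ∀ {k j v} → k ≤′ j → within k v ≡ true → within j v ≡ true
  within-mono (≤′-reflexive refl) wk = wk
  within-mono {v = v} (≤′-step k≤′j) wk rewrite within-mono {v = v} k≤′j wk = refl

  within-step : ∀ {k u v} → within k u ≡ true → Adj G u v → within (suc k) v ≡ true
  within-step {k} {u} {v} wu u∼v =
    trans (cong (within k v ∨_) (anyᵇ-intro u (trans (cong (_∧ adj u v) wu) (Adj⇒adj u∼v)))) (∨-zeroʳ (within k v))

  within-reach : ∀ {k u v} → Reach G u v → within k u ≡ true → ∃[ j ] within j v ≡ true
  within-reach {k} here           wu = k , wu
  within-reach {k} (step u∼w w⇝v) wu = within-reach {suc k} w⇝v (within-step {k} wu u∼w)

  least : ∀ v m → within m v ≡ true →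
          Σ ℕ λ k → within k v ≡ true × (∀ j → j < k → within j v ≡ false)
  least v zero    w0 = 0 , w0 , λ j ()
  least v (suc m) wm with within m v Boolₚ.≟ true
  ... | yes wm' = least v m wm'
  ... | no ¬wm' = suc m , wm , λ j j<1+m → ¬-not λ wj → ¬wm' (within-mono (ℕₚ.≤⇒≤′ (ℕₚ.≤-pred j<1+m)) wj)

  minimal-depth : ∀ v → Σ ℕ λ k → within k v ≡ true × (∀ j → j < k → within j v ≡ false)
  minimal-depth v = let j , wj = within-reach {0} (connected root v) within-root in least v j wj

  depth : Fin n → ℕ
  depth v = proj₁ (minimal-depth v)

  within-depth : ∀ v → within (depth v) v ≡ true
  within-depth v = proj₁ (proj₂ (minimal-depth v))

  depth-≤ : ∀ {k v} → within k v ≡ true → depth v ≤ k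
  depth-≤ {k} {v} wk = ℕₚ.≮⇒≥ λ k<depth → true≢false (trans (sym wk) (proj₂ (proj₂ (minimal-depth v)) k k<depth))

  depth-adj : ∀ {u v} → Adj G u v → depth v ≤ suc (depth u)
  depth-adj {u} u∼v = depth-≤ (within-step {depth u} (within-depth u) u∼v)

  depth-zero : ∀ {v} → depth v ≡ 0 → v ≡ root
  depth-zero {v} d≡0 = within-zero (subst (λ k → within k v ≡ true) d≡0 (within-depth v))

  reached-from : ∀ {k v} → within k v ≡ false → within (suc k) v ≡ true → ∃ λ u → within k u ≡ true × Adj G u v
  reached-from {k} {v} wk≡false w1+k =
    let u , wu∧u∼v = anyᵇ-elim (trans (cong (_∨ anyᵇ (λ u → within k u ∧ adj u v)) (sym wk≡false)) w1+k)
    in u , Boolₚ.∧-conicalˡ _ _ wu∧u∼v , adj⇒Adj (Boolₚ.∧-conicalʳ _ _ wu∧u∼v)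

  parent : ∀ {v k} → depth v ≡ suc k → ∃ λ u → Adj G u v × depth u ≡ k
  parent {v} {k} d≡1+k with within k v Boolₚ.≟ true
  ... | yes wk = ⊥-elim (ℕₚ.1+n≰n (subst (_≤ k) d≡1+k (depth-≤ wk)))
  ... | no ¬wk =
    let u , wu , u∼v = reached-from {k} (¬-not ¬wk) (subst (λ j → within j v ≡ true) d≡1+k (within-depth v))
        k≤du = ℕₚ.≮⇒≥ λ du<k → ¬wk (within-mono (ℕₚ.≤⇒≤′ du<k) (within-step {depth u} (within-depth u) u∼v))
    in u , u∼v , ℕₚ.≤-antisym (depth-≤ wu) k≤du

  depth-≢ : ∀ {x y k} → depth x ≡ suc k → depth y ≤ k → x ≢ y
  depth-≢ {x} {y} {k} dx dy refl = ℕₚ.1+n≰n (subst (_≤ k) dx dy)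

  path : ∀ k {a b} → depth a ≡ k → depth b ≡ k → a ≢ b →
         ∃ λ w → ∃ λ ws → let route = a ∷ w ∷ ws ++ [ b ] in
           Chain G route × Unique route × All (λ x → depth x ≤ k) route
  path zero da db a≢b = ⊥-elim (a≢b (trans (depth-zero da) (sym (depth-zero db))))
  path (suc k) {a} {b} da db a≢b with parent da | parent db
  ... | a' , a'∼a , da' | b' , b'∼b , db' with a' ≟ b'
  ... | yes refl =
    a' , [] , (Adj-sym a'∼a , b'∼b , tt) ,
    ((depth-≢ da (ℕₚ.≤-reflexive da') ∷ a≢b ∷ []) ∷ ((λ a'≡b → depth-≢ db (ℕₚ.≤-reflexive da') (sym a'≡b)) ∷ []) ∷ [] ∷ []) ,
    (ℕₚ.≤-reflexive da ∷ ℕₚ.m≤n⇒m≤1+n (ℕₚ.≤-reflexive da') ∷ ℕₚ.≤-reflexive db ∷ [])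
  ... | no a'≢b' with path k da' db' a'≢b'
  ... | w , ws , chain , distinct , low =
    a' , (w ∷ ws ++ [ b' ]) , (Adj-sym a'∼a , chain-snoc a' (w ∷ ws) b' b chain b'∼b) ,
    (Allₚ.++⁺ (All.map (depth-≢ da) low) (a≢b ∷ []) ∷ unique-snoc distinct (All.map (λ dx x≡b → depth-≢ db dx (sym x≡b)) low)) ,
    (ℕₚ.≤-reflexive da ∷ Allₚ.++⁺ (All.map ℕₚ.m≤n⇒m≤1+n low) (ℕₚ.≤-reflexive db ∷ []))

  adjacent-layers : ∀ {u v} → Adj G u v → (depth v ≡ suc (depth u)) ⊎ (depth u ≡ suc (depth v))
  adjacent-layers {u} {v} u∼v with ℕₚ.m≤n⇒m<n∨m≡n (depth-adj u∼v) | ℕₚ.m≤n⇒m<n∨m≡n (depth-adj (Adj-sym u∼v))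
  ... | inj₂ dv≡1+du | _            = inj₁ dv≡1+du
  ... | inj₁ _       | inj₂ du≡1+dv = inj₂ du≡1+dv
  ... | inj₁ dv<1+du | inj₁ du<1+dv = ⊥-elim (same-depth (ℕₚ.≤-antisym (ℕₚ.≤-pred du<1+dv) (ℕₚ.≤-pred dv<1+du)))
    where
    same-depth : depth u ≢ depth v
    same-depth du≡dv with u ≟ v
    ... | yes refl = Adj-irrefl u∼v
    ... | no u≢v with path (depth u) refl (sym du≡dv) u≢v
    ... | w , ws , chain , distinct , _ =
      acyclic u (w ∷ ws ++ [ v ]) (distinct , s≤s (1≤length-snoc ws v) , chain-snoc u (w ∷ ws) v u chain (Adj-sym u∼v))

  unique-parent : ∀ {u u' v} → Adj G u v → Adj G u' v → depth v ≡ suc (depth u) → depth v ≡ suc (depth u') → u ≡ u'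
  unique-parent {u} {u'} {v} u∼v u'∼v dv du' with u ≟ u'
  ... | yes u≡u' = u≡u'
  ... | no u≢u' with path (depth u) refl (ℕₚ.suc-injective (trans (sym du') dv)) u≢u'
  ... | w , ws , chain , distinct , low =
    ⊥-elim (acyclic v (u ∷ w ∷ ws ++ [ u' ])
      ((All.map (depth-≢ dv) low ∷ distinct) , s≤s (s≤s z≤n) , (Adj-sym u∼v , chain-snoc u (w ∷ ws) u' v chain u'∼v)))

  layering : Layering
  layering = record { depth = depth ; adjacent-layers = adjacent-layers ; unique-parent = unique-parent }

VSet : ℕ → Set
VSet n = Fin n → Bool

module _ {n : ℕ} where
  remove : Fin n → VSet n → VSet n
  remove w = update w false

  removed : ∀ w (W : VSet n) → remove w W w ≡ false
  removed w W = update-same w false W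

  remove-⊆ : ∀ {w v} (W : VSet n) → remove w W v ≡ true → W v ≡ true
  remove-⊆ {w} {v} W rv = by-cases v w (λ { refl → ⊥-elim (true≢false (trans (sym rv) (removed w W))) })
                                        (λ v≢w → trans (sym (update-other false W v≢w)) rv)

  remove-≢ : ∀ {w v} (W : VSet n) → remove w W v ≡ true → v ≢ w
  remove-≢ {w} W rv refl = true≢false (trans (sym rv) (removed w W))

  remove-∈ : ∀ {w v} (W : VSet n) → W v ≡ true → v ≢ w → remove w W v ≡ true
  remove-∈ W Wv v≢w = trans (update-other false W v≢w) Wv

  remove-∉ : ∀ {w v} (W : VSet n) → W v ≡ false → remove w W v ≡ false
  remove-∉ W Wv≡false = ¬-not λ rv → true≢false (trans (sym (remove-⊆ W rv)) Wv≡false)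

  not-larger : ∀ (W : VSet n) w → count (remove w W) ≤ count W
  not-larger W w = subst (count (remove w W) ≤_) (sym (count-remove W w)) (ℕₚ.m≤m+n _ _)

  smaller : ∀ (W : VSet n) w → W w ≡ true → suc (count (remove w W)) ≤ count W
  smaller W w Ww = ℕₚ.≤-reflexive (sym (trans (count-remove W w) (trans (cong (λ b → count (remove w W) + ind b) Ww)
                                                                       (ℕₚ.+-comm _ 1))))

  ∉-≢ : ∀ {W : VSet n} {u v} → W u ≡ true → W v ≡ false → u ≢ v
  ∉-≢ Wu Wv refl = true≢false (trans (sym Wu) Wv)

subset-count : ∀ {m} (P : Subset m) → ∣ P ∣ ≡ count (lookup P)
subset-count []ᵥ           = refl
subset-count (true  ∷ᵥ P) = cong suc (subset-count P)
subset-count (false ∷ᵥ P) = subset-count P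

∈⇔lookup : ∀ {m} (P : Subset m) v → v ∈ P ⇔ lookup P v ≡ true
∈⇔lookup P v = mk⇔ Vecₚ.[]=⇒lookup (Vecₚ.lookup⇒[]= v P)

lookup-agrees : ∀ {m} {Q : Fin m → Set} (P : Subset m) (b : Fin m → Bool) → (∀ v → v ∈ P ⇔ Q v) →
                (∀ v → b v ≡ true → Q v) → (∀ v → Q v → b v ≡ true) → ∀ v → lookup P v ≡ b v
lookup-agrees P b P-is sound complete v =
  bool-ext (λ Pv → complete v (to (P-is v) (from (∈⇔lookup P v) Pv)))
           (λ bv → to (∈⇔lookup P v) (from (P-is v) (sound v bv)))
  where open Equivalence

-- An isolated vertex adds one to α and
-- to |Supp|; a pendant pair ℓ, p adds one to ν and to α, and is either a core
-- vertex and a support vertex (b = true) or two vertices of F_N.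
suc+suc : ∀ m → suc m + suc m ≡ 2 + (m + m)
suc+suc = solve-∀

double-suc : ∀ {a s r} → a + a ≡ (s + s) + r → suc a + suc a ≡ (suc s + suc s) + r
double-suc {a} {s} {r} eq = trans (suc+suc a) (trans (cong (2 +_) eq) (sym (shape s r)))
  where
  shape : ∀ s r → suc s + suc s + r ≡ 2 + (s + s + r)
  shape = solve-∀

pendant-ν : ∀ b {m c r} → m + m ≡ (c + c) + r →
            suc m + suc m ≡ (c + 0 + ind b + (c + 0 + ind b)) + (r + ind (not b) + ind (not b))
pendant-ν true  {m} {c} {r} eq = trans (suc+suc m) (trans (cong (2 +_) eq) (sym (shape c r)))
  where
  shape : ∀ c r → c + 0 + 1 + (c + 0 + 1) + (r + 0 + 0) ≡ 2 + (c + c + r)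
  shape = solve-∀
pendant-ν false {m} {c} {r} eq = trans (suc+suc m) (trans (cong (2 +_) eq) (sym (shape c r)))
  where
  shape : ∀ c r → c + 0 + 0 + (c + 0 + 0) + (r + 1 + 1) ≡ 2 + (c + c + r)
  shape = solve-∀

pendant-α : ∀ b {m s r} → m + m ≡ (s + s) + r →
            suc m + suc m ≡ (s + ind b + 0 + (s + ind b + 0)) + (r + ind (not b) + ind (not b))
pendant-α true  {m} {s} {r} eq = trans (suc+suc m) (trans (cong (2 +_) eq) (sym (shape s r)))
  where
  shape : ∀ s r → s + 1 + 0 + (s + 1 + 0) + (r + 0 + 0) ≡ 2 + (s + s + r)
  shape = solve-∀
pendant-α false {m} {s} {r} eq = trans (suc+suc m) (trans (cong (2 +_) eq) (sym (shape s r)))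
  where
  shape : ∀ s r → s + 0 + 0 + (s + 0 + 0) + (r + 1 + 1) ≡ 2 + (s + s + r)
  shape = solve-∀

doubled : ∀ {x k c r X F} → x ≡ k → k + k ≡ (c + c) + r → X ≡ c → F ≡ r → 2 * x ≡ 2 * X + F
doubled {x} {k} {c} {r} {X} {F} x≡k eq X≡c F≡r = begin
  2 * x          ≡⟨ two x ⟩
  x + x          ≡⟨ cong (λ y → y + y) x≡k ⟩
  k + k          ≡⟨ eq ⟩
  (c + c) + r    ≡⟨ cong (_+ r) (two c) ⟨
  2 * c + r      ≡⟨ cong₂ (λ a b → 2 * a + b) X≡c F≡r ⟨
  2 * X + F      ∎
  where
  open ≡-Reasoning
  two : ∀ x → 2 * x ≡ x + x
  two = solve-∀

module Layered {n : ℕ} (G : Graph n) (L : Basics.Layering G) where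
  open Graph G using (adj)
  open Basics G
  open Layering L

  -- x lies in the null space of the adjacency matrix of G[W] (extended by 0).
  NullIn : VSet n → (Fin n → ℚ) → Set
  NullIn W x = (∀ v → W v ≡ false → x v ≡ 0ℚ) × (∀ v → W v ≡ true → rowSum v x ≡ 0ℚ)

  SuppIn : VSet n → Fin n → Set
  SuppIn W v = Σ (Fin n → ℚ) λ x → NullIn W x × x v ≢ 0ℚ

  SuppIn-⊆ : ∀ {W v} → SuppIn W v → W v ≡ true
  SuppIn-⊆ {W} {v} (x , (vanish , _) , xv≢0) with W v in Wv
  ... | true  = refl
  ... | false = ⊥-elim (xv≢0 (vanish v Wv))

  MatchingIn : VSet n → List (Fin n × Fin n) → Set
  MatchingIn W M = IsMatching G M × All (λ v → W v ≡ true) (endpoints G M)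

  IndependentIn : VSet n → VSet n → Set
  IndependentIn W I = (∀ v → I v ≡ true → W v ≡ true) × (∀ u v → I u ≡ true → I v ≡ true → ¬ Adj G u v)

  MatchingNumberIn : VSet n → ℕ → Set
  MatchingNumberIn W k = (∃ λ M → MatchingIn W M × length M ≡ k) × (∀ M → MatchingIn W M → length M ≤ k)

  IndependenceNumberIn : VSet n → ℕ → Set
  IndependenceNumberIn W k = (∃ λ I → IndependentIn W I × count I ≡ k) × (∀ I → IndependentIn W I → count I ≤ k)

  -- Given the support S of G[W]: its core N(S) and the vertices of F_N(G[W]).
  coreIn : VSet n → VSet n → VSet n
  coreIn W S v = W v ∧ anyᵇ (λ u → S u ∧ adj u v)

  restIn : VSet n → VSet n → VSet n
  restIn W S v = W v ∧ (not (S v) ∧ not (coreIn W S v))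

  record Identities (W : VSet n) : Set where
    field
      supp          : VSet n
      supp-sound    : ∀ v → supp v ≡ true → SuppIn W v
      supp-complete : ∀ v → SuppIn W v → supp v ≡ true
      ν             : ℕ
      ν-is          : MatchingNumberIn W ν
      α             : ℕ
      α-is          : IndependenceNumberIn W α
      ν-identity    : ν + ν ≡ (count (coreIn W supp) + count (coreIn W supp)) + count (restIn W supp)
      α-identity    : α + α ≡ (count supp + count supp) + count (restIn W supp)

  ∅ : VSet n
  ∅ _ = false

  count-∅ : count ∅ ≡ 0
  count-∅ = count-none {f = ∅} (λ _ → refl)

  identities-empty : ∀ {W} → (∀ v → W v ≡ false) → Identities W
  identities-empty {W} empty = record
    { supp          = ∅
    ; supp-sound    = λ v ()
    ; supp-complete = λ v s → ⊥-elim (true≢false (trans (sym (SuppIn-⊆ s)) (empty v)))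
    ; ν             = 0
    ; ν-is          = ([] , (([] , []) , []) , refl) , no-edges
    ; α             = 0
    ; α-is          = (∅ , ((λ v ()) , (λ u v ())) , count-∅) ,
                      λ I (I⊆W , _) → ℕₚ.≤-reflexive (count-none λ v → ¬-not λ Iv → true≢false (trans (sym (I⊆W v Iv)) (empty v)))
    ; ν-identity    = sym (cong₂ (λ c r → (c + c) + r) (count-none core-empty) (count-none rest-empty))
    ; α-identity    = sym (cong₂ (λ s r → (s + s) + r) count-∅ (count-none rest-empty))
    }
    where
    no-edges : ∀ M → MatchingIn W M → length M ≤ 0
    no-edges []      _                  = z≤n
    no-edges (_ ∷ _) (_ , (Wa ∷ _)) = ⊥-elim (true≢false (trans (sym Wa) (empty _)))
    core-empty : ∀ v → coreIn W ∅ v ≡ false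
    core-empty v = cong (_∧ anyᵇ (λ u → false ∧ adj u v)) (empty v)
    rest-empty : ∀ v → restIn W ∅ v ≡ false
    rest-empty v = cong (_∧ (true ∧ not (coreIn W ∅ v))) (empty v)

  rest-cong : ∀ {W W' S S' v} → W v ≡ W' v → S v ≡ S' v → coreIn W S v ≡ coreIn W' S' v →
              restIn W S v ≡ restIn W' S' v
  rest-cong W≡ S≡ C≡ = cong₂ _∧_ W≡ (cong₂ _∧_ (cong not S≡) (cong not C≡))

  matching-mono : ∀ {W W' M} → (∀ {v} → W' v ≡ true → W v ≡ true) → MatchingIn W' M → MatchingIn W M
  matching-mono W'⊆W (matching , inW') = matching , All.map W'⊆W inW'

  insert-independent : ∀ {W W' I} ℓ → W ℓ ≡ true → (∀ {v} → W' v ≡ true → W v ≡ true) →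
                       (∀ u → W' u ≡ true → adj ℓ u ≡ false) → IndependentIn W' I →
                       IndependentIn W (update ℓ true I)
  insert-independent {W} {W'} {I} ℓ Wℓ W'⊆W no-nbr (I⊆W' , indep) = ⊆W , indep'
    where
    old : ∀ {v} → v ≢ ℓ → update ℓ true I v ≡ true → I v ≡ true
    old v≢ℓ Iv = trans (sym (update-other true I v≢ℓ)) Iv
    ⊆W : ∀ v → update ℓ true I v ≡ true → W v ≡ true
    ⊆W v Iv = by-cases v ℓ (λ { refl → Wℓ }) (λ v≢ℓ → W'⊆W (I⊆W' v (old v≢ℓ Iv)))
    not-adj-ℓ : ∀ {u} → u ≢ ℓ → update ℓ true I u ≡ true → ¬ Adj G ℓ u
    not-adj-ℓ u≢ℓ Iu ℓ∼u = true≢false (trans (sym (Adj⇒adj ℓ∼u)) (no-nbr _ (I⊆W' _ (old u≢ℓ Iu))))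
    indep' : ∀ u v → update ℓ true I u ≡ true → update ℓ true I v ≡ true → ¬ Adj G u v
    indep' u v Iu Iv u∼v = by-cases u ℓ
      (λ { refl → by-cases v ℓ (λ { refl → Adj-irrefl u∼v }) (λ v≢ℓ → not-adj-ℓ v≢ℓ Iv u∼v) })
      (λ u≢ℓ → by-cases v ℓ (λ { refl → not-adj-ℓ u≢ℓ Iu (Adj-sym u∼v) })
                            (λ v≢ℓ → indep u v (old u≢ℓ Iu) (old v≢ℓ Iv) u∼v))

  remove-independent : ∀ {W I} w → IndependentIn W I → IndependentIn (remove w W) (remove w I)
  remove-independent {W} {I} w (I⊆W , indep) =
    (λ v Iv → remove-∈ W (I⊆W v (remove-⊆ I Iv)) (remove-≢ I Iv)) ,
    (λ u v Iu Iv → indep u v (remove-⊆ I Iu) (remove-⊆ I Iv))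

  -- Induction step for a vertex ℓ without neighbours in W: ℓ joins the
  -- support and every maximum independent set, and nothing else changes.
  module Isolated (W : VSet n) (ℓ : Fin n) (Wℓ : W ℓ ≡ true)
                  (isolated : ∀ u → W u ≡ true → adj ℓ u ≡ false) (I' : Identities (remove ℓ W)) where
    W' : VSet n
    W' = remove ℓ W
    module I' = Identities I'
    S' = I'.supp

    isolated' : ∀ {u} → W u ≡ true → adj u ℓ ≡ false
    isolated' {u} Wu = trans (adj-sym u ℓ) (isolated u Wu)

    restrict : ∀ {x} → NullIn W x → NullIn W' (update ℓ 0ℚ x)
    restrict {x} (vanish , rows) = vanish' , rows'
      where
      vanish' : ∀ v → W' v ≡ false → update ℓ 0ℚ x v ≡ 0ℚ
      vanish' v W'v = by-cases v ℓ (λ { refl → update-same ℓ 0ℚ x })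
        (λ v≢ℓ → trans (update-other 0ℚ x v≢ℓ) (vanish v (trans (sym (update-other false W v≢ℓ)) W'v)))
      rows' : ∀ v → W' v ≡ true → rowSum v (update ℓ 0ℚ x) ≡ 0ℚ
      rows' v W'v = trans (rowSum-agree (λ u u≢ℓ → update-other 0ℚ x u≢ℓ) (isolated' (remove-⊆ W W'v)))
                          (rows v (remove-⊆ W W'v))

    extend : ∀ {y} → NullIn W' y → NullIn W y
    extend {y} (vanish , rows) = (λ v Wv → vanish v (remove-∉ W Wv)) , rows'
      where
      row-ℓ : rowSum ℓ y ≡ 0ℚ
      row-ℓ = sum-zero _ λ u → bool-cases (W' u)
        (λ W'u → A-nonadj (y u) (isolated u (remove-⊆ W W'u)))
        (λ W'u → A-zero (vanish u W'u))
      rows' : ∀ v → W v ≡ true → rowSum v y ≡ 0ℚ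
      rows' v Wv = by-cases v ℓ (λ { refl → row-ℓ }) (λ v≢ℓ → rows v (remove-∈ W Wv v≢ℓ))

    unit-null : NullIn W (unit ℓ)
    unit-null = (λ v Wv → unit-off {ℓ} {v} (∉-≢ {W = W} Wℓ Wv ∘ sym)) ,
                (λ v Wv → rowSum-unit-nonadj (by-cases v ℓ (λ { refl → Graph.irrefl G ℓ }) (λ _ → isolated' Wv)))

    supp : VSet n
    supp = update ℓ true S'

    supp-sound : ∀ v → supp v ≡ true → SuppIn W v
    supp-sound v Sv = by-cases v ℓ
      (λ { refl → unit ℓ , unit-null , (λ u≡0 → ℚₚ.1≢0 (trans (sym (update-same ℓ 1ℚ _)) u≡0)) })
      (λ v≢ℓ → let y , null , yv≢0 = I'.supp-sound v (trans (sym (update-other true S' v≢ℓ)) Sv)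
               in y , extend null , yv≢0)

    supp-complete : ∀ v → SuppIn W v → supp v ≡ true
    supp-complete v (x , null , xv≢0) = by-cases v ℓ (λ { refl → update-same ℓ true S' })
      (λ v≢ℓ → trans (update-other true S' v≢ℓ)
        (I'.supp-complete v (update ℓ 0ℚ x , restrict null , λ x'v≡0 → xv≢0 (trans (sym (update-other 0ℚ x v≢ℓ)) x'v≡0))))

    -- ℓ is the endpoint of no edge of G[W], so matchings of G[W] live in G[W'].
    avoid-ℓ : ∀ M → All (λ e → Adj G (proj₁ e) (proj₂ e)) M → All (λ v → W v ≡ true) (endpoints G M) →
              All (λ v → W' v ≡ true) (endpoints G M)
    avoid-ℓ []            []           []              = []
    avoid-ℓ ((a , b) ∷ M) (a∼b ∷ edges) (Wa ∷ Wb ∷ inW) =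
      remove-∈ W Wa (λ { refl → true≢false (trans (sym (Adj⇒adj a∼b)) (isolated b Wb)) }) ∷
      remove-∈ W Wb (λ { refl → true≢false (trans (sym (Adj⇒adj a∼b)) (isolated' Wa)) }) ∷
      avoid-ℓ M edges inW

    ν-is : MatchingNumberIn W I'.ν
    ν-is = let (M , matching , size) , bound = I'.ν-is
           in (M , matching-mono (remove-⊆ W) matching , size) ,
              λ M (matching , inW) → bound M (matching , avoid-ℓ M (proj₁ matching) inW)

    α-is : IndependenceNumberIn W (suc I'.α)
    α-is = let (I , indep , size) , bound = I'.α-is
               Iℓ≡false = ¬-not λ Iℓ → true≢false (trans (sym (proj₁ indep ℓ Iℓ)) (removed ℓ W))
           in (update ℓ true I , insert-independent ℓ Wℓ (remove-⊆ W) (λ u W'u → isolated u (remove-⊆ W W'u)) indep ,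
               trans (count-insert I ℓ Iℓ≡false) (cong suc size)) ,
              λ J indep-J → begin
                count J                           ≡⟨ count-remove J ℓ ⟩
                count (remove ℓ J) + ind (J ℓ)    ≤⟨ ℕₚ.+-mono-≤ (bound (remove ℓ J) (remove-independent ℓ indep-J)) (ind≤1 (J ℓ)) ⟩
                I'.α + 1                          ≡⟨ ℕₚ.+-comm I'.α 1 ⟩
                suc I'.α                          ∎
      where open ℕₚ.≤-Reasoning

    core-off-ℓ : ∀ v → v ≢ ℓ → coreIn W supp v ≡ coreIn W' S' v
    core-off-ℓ v v≢ℓ = ∧-guard (sym (update-other false W v≢ℓ)) λ Wv → anyᵇ-ext λ u → by-cases u ℓ
      (λ { refl → trans (∧-false (supp ℓ) (isolated v Wv)) (sym (∧-false (S' ℓ) (isolated v Wv))) })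
      (λ u≢ℓ → cong (_∧ adj u v) (update-other true S' u≢ℓ))

    core-ℓ : coreIn W supp ℓ ≡ false
    core-ℓ = ∧-false (W ℓ) (anyᵇ-none λ u → bool-cases (supp u)
      (λ Su → ∧-false (supp u) (isolated' (SuppIn-⊆ (supp-sound u Su))))
      (λ Su → cong (_∧ adj u ℓ) Su))

    core'-ℓ : coreIn W' S' ℓ ≡ false
    core'-ℓ = cong (_∧ anyᵇ (λ u → S' u ∧ adj u ℓ)) (removed ℓ W)

    count-core : count (coreIn W supp) ≡ count (coreIn W' S')
    count-core = trans (count-off-one {f = coreIn W supp} {g = coreIn W' S'} ℓ core-off-ℓ core'-ℓ)
                       (trans (cong (λ b → count (coreIn W' S') + ind b) core-ℓ) (ℕₚ.+-identityʳ _))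

    count-rest : count (restIn W supp) ≡ count (restIn W' S')
    count-rest = trans (count-off-one {f = restIn W supp} {g = restIn W' S'} ℓ (λ v v≢ℓ → rest-cong {W = W} {W'} {supp} {S'} (sym (update-other false W v≢ℓ)) (update-other true S' v≢ℓ) (core-off-ℓ v v≢ℓ))
                                        (cong (_∧ (not (S' ℓ) ∧ not (coreIn W' S' ℓ))) (removed ℓ W)))
                       (trans (cong (λ b → count (restIn W' S') + ind b) rest-ℓ) (ℕₚ.+-identityʳ _))
      where
      rest-ℓ : restIn W supp ℓ ≡ false
      rest-ℓ = ∧-false (W ℓ) (cong (λ b → not b ∧ not (coreIn W supp ℓ)) (update-same ℓ true S'))

    identities : Identities W
    identities = record
      { supp = supp ; supp-sound = supp-sound ; supp-complete = supp-complete
      ; ν = I'.ν ; ν-is = ν-is ; α = suc I'.α ; α-is = α-is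
      ; ν-identity = trans I'.ν-identity (sym (cong₂ (λ c r → (c + c) + r) count-core count-rest))
      ; α-identity = trans (double-suc {s = count S'} I'.α-identity)
                           (sym (cong₂ (λ s r → (s + s) + r) (count-insert S' ℓ S'ℓ) count-rest))
      }
      where
      S'ℓ : S' ℓ ≡ false
      S'ℓ = ¬-not λ S'ℓ → true≢false (trans (sym (SuppIn-⊆ (I'.supp-sound ℓ S'ℓ))) (removed ℓ W))

  -- Induction step for a deepest vertex ℓ of W with a neighbour p in W: then
  -- p is the parent of ℓ and ℓ's only neighbour in W.  We compare G[W] with
  -- G[W'] for W' = W ∖ {ℓ, p}.  Every null vector vanishes at p, and ℓ lies in
  -- the support iff p has a neighbour in the support of G[W'].
  module Pendant (W : VSet n) (ℓ p : Fin n) (Wℓ : W ℓ ≡ true) (Wp : W p ≡ true) (ℓ∼p : adj ℓ p ≡ true)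
                 (pendant : ∀ u → W u ≡ true → adj ℓ u ≡ true → u ≡ p)
                 (deepest : ∀ v → W v ≡ true → depth v ≤ depth ℓ) (ℓ-child : depth ℓ ≡ suc (depth p))
                 (I' : Identities (remove p (remove ℓ W))) where
    W' : VSet n
    W' = remove p (remove ℓ W)
    module I' = Identities I'
    S' = I'.supp

    ℓ≢p : ℓ ≢ p
    ℓ≢p refl = true≢false (trans (sym ℓ∼p) (Graph.irrefl G ℓ))

    p∼ℓ : adj p ℓ ≡ true
    p∼ℓ = trans (adj-sym p ℓ) ℓ∼p

    W'ℓ : W' ℓ ≡ false
    W'ℓ = trans (update-other false (remove ℓ W) ℓ≢p) (removed ℓ W)

    W'p : W' p ≡ false
    W'p = removed p (remove ℓ W)

    W'⊆W : ∀ {v} → W' v ≡ true → W v ≡ true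
    W'⊆W {v} W'v = remove-⊆ {w = ℓ} {v} W (remove-⊆ {w = p} {v} (remove ℓ W) W'v)

    W'-≢p : ∀ {v} → W' v ≡ true → v ≢ p
    W'-≢p {v} = remove-≢ {w = p} {v} (remove ℓ W)

    W'-∈ : ∀ {v} → W v ≡ true → v ≢ ℓ → v ≢ p → W' v ≡ true
    W'-∈ Wv v≢ℓ v≢p = remove-∈ (remove ℓ W) (remove-∈ W Wv v≢ℓ) v≢p

    W'-∉ : ∀ {v} → W v ≡ false → W' v ≡ false
    W'-∉ {v} Wv = remove-∉ {w = p} {v} (remove ℓ W) (remove-∉ {w = ℓ} {v} W Wv)

    W'-off : ∀ {v} → W' v ≡ false → v ≢ ℓ → v ≢ p → W v ≡ false
    W'-off W'v v≢ℓ v≢p = ¬-not λ Wv → true≢false (trans (sym (W'-∈ Wv v≢ℓ v≢p)) W'v)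

    S'-⊆ : ∀ {v} → S' v ≡ true → W' v ≡ true
    S'-⊆ {v} S'v = SuppIn-⊆ (I'.supp-sound v S'v)

    S'-∉ : ∀ {v} → W' v ≡ false → S' v ≡ false
    S'-∉ W'v = ¬-not λ S'v → true≢false (trans (sym (S'-⊆ S'v)) W'v)

    ℓ-nonadj : ∀ {u} → W u ≡ true → u ≢ p → adj ℓ u ≡ false
    ℓ-nonadj {u} Wu u≢p = ¬-not λ ℓ∼u → u≢p (pendant u Wu ℓ∼u)

    nonadj-ℓ : ∀ {u} → W u ≡ true → u ≢ p → adj u ℓ ≡ false
    nonadj-ℓ {u} Wu u≢p = trans (adj-sym u ℓ) (ℓ-nonadj Wu u≢p)

    -- Row ℓ forces every null vector of G[W] to vanish at p.
    null-at-p : ∀ {x} → NullIn W x → x p ≡ 0ℚ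
    null-at-p {x} (vanish , rows) = trans (sym (rowSum-single x others ℓ∼p)) (rows ℓ Wℓ)
      where
      others : ∀ u → u ≢ p → A G ℓ u *ℚ x u ≡ 0ℚ
      others u u≢p = bool-cases (W u) (λ Wu → A-nonadj (x u) (ℓ-nonadj Wu u≢p)) (λ Wu → A-zero (vanish u Wu))

    restrict : ∀ {x} → NullIn W x → NullIn W' (update ℓ 0ℚ x)
    restrict {x} null@(vanish , rows) = vanish' , rows'
      where
      vanish' : ∀ v → W' v ≡ false → update ℓ 0ℚ x v ≡ 0ℚ
      vanish' v W'v = by-cases v ℓ (λ { refl → update-same ℓ 0ℚ x }) λ v≢ℓ → trans (update-other 0ℚ x v≢ℓ)
        (by-cases v p (λ { refl → null-at-p null }) (λ v≢p → vanish v (W'-off W'v v≢ℓ v≢p)))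
      rows' : ∀ v → W' v ≡ true → rowSum v (update ℓ 0ℚ x) ≡ 0ℚ
      rows' v W'v = trans (rowSum-agree (λ u u≢ℓ → update-other 0ℚ x u≢ℓ) (nonadj-ℓ (W'⊆W W'v) (W'-≢p W'v)))
                          (rows v (W'⊆W W'v))

    -- A null vector y of G[W'] extends to G[W], the value at ℓ balancing row p.
    extend : (Fin n → ℚ) → Fin n → ℚ
    extend y = update ℓ (-ℚ rowSum p y) y

    extend-null : ∀ {y} → NullIn W' y → NullIn W (extend y)
    extend-null {y} (vanish , rows) = vanish' , rows'
      where
      x = extend y
      vanish' : ∀ v → W v ≡ false → x v ≡ 0ℚ
      vanish' v Wv = trans (update-other _ y (∉-≢ {W = W} Wℓ Wv ∘ sym)) (vanish v (W'-∉ Wv))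
      others : ∀ u → u ≢ p → A G ℓ u *ℚ x u ≡ 0ℚ
      others u u≢p = bool-cases (W u) (λ Wu → A-nonadj (x u) (ℓ-nonadj Wu u≢p)) (λ Wu → A-zero (vanish' u Wu))
      row-ℓ : rowSum ℓ x ≡ 0ℚ
      row-ℓ = trans (rowSum-single x others ℓ∼p) (trans (update-other _ y (ℓ≢p ∘ sym)) (vanish p W'p))
      row-p : rowSum p x ≡ 0ℚ
      row-p = begin
        rowSum p x                     ≡⟨ ℚₚ.+-identityʳ _ ⟨
        rowSum p x +ℚ 0ℚ               ≡⟨ cong (rowSum p x +ℚ_) (vanish ℓ W'ℓ) ⟨
        rowSum p x +ℚ y ℓ              ≡⟨ rowSum-update _ y p∼ℓ ⟨
        rowSum p y +ℚ -ℚ rowSum p y    ≡⟨ ℚₚ.+-inverseʳ (rowSum p y) ⟩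
        0ℚ                             ∎
        where open ≡-Reasoning
      rows' : ∀ v → W v ≡ true → rowSum v x ≡ 0ℚ
      rows' v Wv = by-cases v ℓ (λ { refl → row-ℓ }) λ v≢ℓ → by-cases v p (λ { refl → row-p }) λ v≢p →
        trans (rowSum-agree (λ u u≢ℓ → update-other _ y u≢ℓ) (nonadj-ℓ Wv v≢p)) (rows v (W'-∈ Wv v≢ℓ v≢p))

    supp-ℓ-from-row-p : ∀ {y} → NullIn W' y → rowSum p y ≢ 0ℚ → SuppIn W ℓ
    supp-ℓ-from-row-p {y} null row≢0 =
      extend y , extend-null null , λ xℓ≡0 → row≢0 (ℚₚ.neg-injective (trans (sym (update-same ℓ _ y)) xℓ≡0))

    p-sees-supp : Bool
    p-sees-supp = anyᵇ (λ u → S' u ∧ adj p u)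

    supp-ℓ⇒ : SuppIn W ℓ → p-sees-supp ≡ true
    supp-ℓ⇒ (x , null@(_ , rows) , xℓ≢0) =
      let u , term≢0 = sum-nonzero _ row≢0
          p∼u = ¬-not λ p≁u → term≢0 (A-nonadj (y u) p≁u)
          yu≢0 = λ yu≡0 → term≢0 (A-zero yu≡0)
          S'u = I'.supp-complete u (y , restrict null , yu≢0)
      in anyᵇ-intro u (trans (cong (_∧ adj p u) S'u) p∼u)
      where
      y = update ℓ 0ℚ x
      -- row p of y is -x ℓ, hence nonzero
      row≢0 : rowSum p y ≢ 0ℚ
      row≢0 row≡0 = xℓ≢0 (begin
        x ℓ                  ≡⟨ ℚₚ.+-identityˡ _ ⟨
        0ℚ +ℚ x ℓ            ≡⟨ cong (_+ℚ x ℓ) row≡0 ⟨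
        rowSum p y +ℚ x ℓ    ≡⟨ rowSum-update 0ℚ x p∼ℓ ⟨
        rowSum p x +ℚ 0ℚ     ≡⟨ cong (_+ℚ 0ℚ) (rows p Wp) ⟩
        0ℚ                   ∎)
        where open ≡-Reasoning

    -- A child c of p in W' has no neighbour in W' (a deeper one would be deeper
    -- than ℓ, a shallower one would be a second parent of c), so the indicator
    -- vector of c is a null vector of G[W'] with p-th row 1.
    via-child : ∀ {c} → W' c ≡ true → adj p c ≡ true → depth c ≡ suc (depth p) → SuppIn W ℓ
    via-child {c} W'c p∼c dc = supp-ℓ-from-row-p ((λ v W'v → unit-off {c} {v} (∉-≢ {W = W'} W'c W'v ∘ sym)) ,
                                                 (λ v W'v → rowSum-unit-nonadj (c-isolated W'v)))
                                                (λ row≡0 → ℚₚ.1≢0 (trans (sym (rowSum-unit-adj p∼c)) row≡0))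
      where
      c-isolated : ∀ {v} → W' v ≡ true → adj v c ≡ false
      c-isolated {v} W'v = ¬-not λ v∼c → no-layer v∼c (adjacent-layers (adj⇒Adj (trans (adj-sym c v) v∼c)))
        where
        no-layer : adj v c ≡ true → (depth v ≡ suc (depth c)) ⊎ (depth c ≡ suc (depth v)) → ⊥
        no-layer _   (inj₁ dv) = ℕₚ.1+n≰n (subst (_≤ depth ℓ) (trans dv (cong suc (trans dc (sym ℓ-child))))
                                                              (deepest v (W'⊆W W'v)))
        no-layer v∼c (inj₂ dc') = W'-≢p W'v (unique-parent (adj⇒Adj v∼c) (adj⇒Adj p∼c) dc' dc)

    -- If p has no child in W', its only neighbour u in W' is its parent, so row p
    -- of a null vector y of G[W'] is y u.
    via-parent : ∀ {u} → S' u ≡ true → adj p u ≡ true →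
                 (∀ c → W' c ≡ true → adj p c ≡ true → depth c ≢ suc (depth p)) → SuppIn W ℓ
    via-parent {u} S'u p∼u childless =
      supp-ℓ-from-row-p null (λ row≡0 → yu≢0 (trans (sym (rowSum-single y only-u p∼u)) row≡0))
      where
      y = proj₁ (I'.supp-sound u S'u)
      null = proj₁ (proj₂ (I'.supp-sound u S'u))
      yu≢0 = proj₂ (proj₂ (I'.supp-sound u S'u))
      W'u = S'-⊆ S'u
      p-above : ∀ {w} → W' w ≡ true → adj p w ≡ true → depth p ≡ suc (depth w)
      p-above {w} W'w p∼w with adjacent-layers (adj⇒Adj p∼w)
      ... | inj₁ child = ⊥-elim (childless w W'w p∼w child)
      ... | inj₂ above = above
      only-u : ∀ w → w ≢ u → A G p w *ℚ y w ≡ 0ℚ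
      only-u w w≢u = bool-cases (W' w)
        (λ W'w → A-nonadj (y w) (¬-not λ p∼w → w≢u (unique-parent (adj⇒Adj (trans (adj-sym w p) p∼w))
                                                                (adj⇒Adj (trans (adj-sym u p) p∼u))
                                                                (p-above W'w p∼w) (p-above W'u p∼u))))
        (λ W'w → A-zero (proj₁ null w W'w))

    ⇒supp-ℓ : p-sees-supp ≡ true → SuppIn W ℓ
    ⇒supp-ℓ sees with anyᵇ-elim {f = λ u → S' u ∧ adj p u} sees
    ... | u , S'u∧p∼u
        with any? (λ c → (W' c Boolₚ.≟ true) ×-dec (adj p c Boolₚ.≟ true) ×-dec (depth c ℕₚ.≟ suc (depth p)))
    ...   | yes (c , W'c , p∼c , dc) = via-child W'c p∼c dc
    ...   | no  no-child = via-parent (Boolₚ.∧-conicalˡ _ _ S'u∧p∼u) (Boolₚ.∧-conicalʳ _ _ S'u∧p∼u)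
                                      (λ c W'c p∼c dc → no-child (c , W'c , p∼c , dc))

    supp : VSet n
    supp = update ℓ p-sees-supp S'

    supp-p : supp p ≡ false
    supp-p = trans (update-other _ S' (ℓ≢p ∘ sym)) (S'-∉ W'p)

    supp-sound : ∀ v → supp v ≡ true → SuppIn W v
    supp-sound v Sv = by-cases v ℓ (λ { refl → ⇒supp-ℓ (trans (sym (update-same ℓ p-sees-supp S')) Sv) })
      (λ v≢ℓ → let y , null , yv≢0 = I'.supp-sound v (trans (sym (update-other _ S' v≢ℓ)) Sv)
               in extend y , extend-null null , λ xv≡0 → yv≢0 (trans (sym (update-other _ y v≢ℓ)) xv≡0))

    supp-complete : ∀ v → SuppIn W v → supp v ≡ true
    supp-complete v sv@(x , null , xv≢0) = by-cases v ℓ (λ { refl → trans (update-same ℓ _ S') (supp-ℓ⇒ sv) })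
      (λ v≢ℓ → trans (update-other _ S' v≢ℓ)
        (I'.supp-complete v (update ℓ 0ℚ x , restrict null , λ yv≡0 → xv≢0 (trans (sym (update-other 0ℚ x v≢ℓ)) yv≡0))))

    core-off : ∀ v → v ≢ ℓ → v ≢ p → coreIn W supp v ≡ coreIn W' S' v
    core-off v v≢ℓ v≢p =
      ∧-guard (sym (trans (update-other false (remove ℓ W) v≢p) (update-other false W v≢ℓ))) λ Wv →
        anyᵇ-ext λ u → by-cases u ℓ
          (λ { refl → trans (∧-false (supp ℓ) (ℓ-nonadj Wv v≢p)) (sym (∧-false (S' ℓ) (ℓ-nonadj Wv v≢p))) })
          (λ u≢ℓ → cong (_∧ adj u v) (update-other _ S' u≢ℓ))

    core-ℓ : coreIn W supp ℓ ≡ false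
    core-ℓ = ∧-false (W ℓ) (anyᵇ-none λ u → bool-cases (supp u)
      (λ Su → ∧-false (supp u) (nonadj-ℓ (SuppIn-⊆ (supp-sound u Su)) λ { refl → true≢false (trans (sym Su) supp-p) }))
      (λ Su → cong (_∧ adj u ℓ) Su))

    core-p : coreIn W supp p ≡ p-sees-supp
    core-p = trans (cong (_∧ anyᵇ (λ u → supp u ∧ adj u p)) Wp) (bool-ext sees⇒ ⇒sees)
      where
      sees⇒ : anyᵇ (λ u → supp u ∧ adj u p) ≡ true → p-sees-supp ≡ true
      sees⇒ found with anyᵇ-elim {f = λ u → supp u ∧ adj u p} found
      ... | u , Su∧u∼p = by-cases u ℓ
        (λ { refl → trans (sym (update-same ℓ p-sees-supp S')) (Boolₚ.∧-conicalˡ _ _ Su∧u∼p) })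
        (λ u≢ℓ → anyᵇ-intro u (cong₂ _∧_ (trans (sym (update-other _ S' u≢ℓ)) (Boolₚ.∧-conicalˡ _ _ Su∧u∼p))
                                         (trans (adj-sym p u) (Boolₚ.∧-conicalʳ _ _ Su∧u∼p))))
      ⇒sees : p-sees-supp ≡ true → anyᵇ (λ u → supp u ∧ adj u p) ≡ true
      ⇒sees sees = anyᵇ-intro ℓ (cong₂ _∧_ (trans (update-same ℓ _ S') sees) ℓ∼p)

    rest-off : ∀ v → v ≢ ℓ → v ≢ p → restIn W supp v ≡ restIn W' S' v
    rest-off v v≢ℓ v≢p = rest-cong {W = W} {W'} {supp} {S'}
      (sym (trans (update-other false (remove ℓ W) v≢p) (update-other false W v≢ℓ)))
      (update-other _ S' v≢ℓ) (core-off v v≢ℓ v≢p)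

    rest-ℓ : restIn W supp ℓ ≡ not p-sees-supp
    rest-ℓ = trans (cong₂ (λ w s → w ∧ (not s ∧ not (coreIn W supp ℓ))) Wℓ (update-same ℓ _ S'))
                   (trans (cong (λ c → not p-sees-supp ∧ not c) core-ℓ) (Boolₚ.∧-identityʳ _))

    rest-p : restIn W supp p ≡ not p-sees-supp
    rest-p = trans (cong₂ (λ w s → w ∧ (not s ∧ not (coreIn W supp p))) Wp supp-p) (cong not core-p)

    count-supp : count supp ≡ count S' + ind p-sees-supp + ind false
    count-supp = trans (count-off-two {f = supp} {g = S'} ℓ p ℓ≢p (λ v v≢ℓ _ → update-other _ S' v≢ℓ) (S'-∉ W'ℓ) (S'-∉ W'p))
                       (cong₂ (λ a b → count S' + ind a + ind b) (update-same ℓ _ S') supp-p)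

    count-core : count (coreIn W supp) ≡ count (coreIn W' S') + ind false + ind p-sees-supp
    count-core = trans (count-off-two {f = coreIn W supp} {g = coreIn W' S'} ℓ p ℓ≢p core-off
                                      (cong (_∧ anyᵇ (λ u → S' u ∧ adj u ℓ)) W'ℓ) (cong (_∧ anyᵇ (λ u → S' u ∧ adj u p)) W'p))
                       (cong₂ (λ a b → count (coreIn W' S') + ind a + ind b) core-ℓ core-p)

    count-rest : count (restIn W supp) ≡ count (restIn W' S') + ind (not p-sees-supp) + ind (not p-sees-supp)
    count-rest = trans (count-off-two {f = restIn W supp} {g = restIn W' S'} ℓ p ℓ≢p rest-off
                                      (cong (_∧ (not (S' ℓ) ∧ not (coreIn W' S' ℓ))) W'ℓ)
                                      (cong (_∧ (not (S' p) ∧ not (coreIn W' S' p))) W'p))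
                       (cong₂ (λ a b → count (restIn W' S') + ind a + ind b) rest-ℓ rest-p)

    -- Edges of G[W] not incident with p avoid ℓ too, as p is ℓ's only neighbour.
    avoid-ℓ : ∀ M → All (λ e → Adj G (proj₁ e) (proj₂ e)) M → All (λ v → W v ≡ true) (endpoints G M) →
              All (_≢ p) (endpoints G M) → All (λ v → W' v ≡ true) (endpoints G M)
    avoid-ℓ []            []            []              []                 = []
    avoid-ℓ ((a , b) ∷ M) (a∼b ∷ edges) (Wa ∷ Wb ∷ inW) (a≢p ∷ b≢p ∷ off) =
      W'-∈ Wa (λ { refl → b≢p (pendant b Wb (Adj⇒adj a∼b)) }) a≢p ∷
      W'-∈ Wb (λ { refl → a≢p (pendant a Wa (trans (adj-sym ℓ a) (Adj⇒adj a∼b))) }) b≢p ∷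
      avoid-ℓ M edges inW off

    -- A maximum matching gains the edge ℓp.
    ν-is : MatchingNumberIn W (suc I'.ν)
    ν-is = let (M , ((edges , distinct) , inW') , size) , bound = I'.ν-is
               ℓ∉ = All.map (λ W'v ℓ≡v → ∉-≢ {W = W'} W'v W'ℓ (sym ℓ≡v)) inW'
               p∉ = All.map (λ W'v p≡v → ∉-≢ {W = W'} W'v W'p (sym p≡v)) inW'
           in ((ℓ , p) ∷ M , (((adj⇒Adj ℓ∼p ∷ edges) , ((ℓ≢p ∷ ℓ∉) ∷ (p∉ ∷ distinct))) , (Wℓ ∷ Wp ∷ All.map W'⊆W inW')) ,
               cong suc size) ,
              λ M ((matching@(edges , distinct)) , inW) →
                let M' = drop-at p M
                    matching' = drop-at-matching p M matching
                in ℕₚ.≤-trans (drop-at-length p M distinct)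
                     (s≤s (bound M' (matching' , avoid-ℓ M' (proj₁ matching') (drop-at-endpoints p M inW) (drop-at-avoids p M))))

    -- A maximum independent set gains ℓ; an independent set contains at most one of ℓ, p.
    α-is : IndependenceNumberIn W (suc I'.α)
    α-is = let (I , indep , size) , bound = I'.α-is
               Iℓ≡false = ¬-not λ Iℓ → true≢false (trans (sym (proj₁ indep ℓ Iℓ)) W'ℓ)
           in (update ℓ true I , insert-independent ℓ Wℓ W'⊆W (λ u W'u → ℓ-nonadj (W'⊆W W'u) (W'-≢p W'u)) indep ,
               trans (count-insert I ℓ Iℓ≡false) (cong suc size)) ,
              λ J indep-J → let J' = remove p (remove ℓ J) in begin
                count J                                           ≡⟨ count-remove J ℓ ⟩
                count (remove ℓ J) + ind (J ℓ)                    ≡⟨ cong (_+ ind (J ℓ)) (count-remove (remove ℓ J) p) ⟩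
                count J' + ind (remove ℓ J p) + ind (J ℓ)         ≡⟨ cong (λ b → count J' + ind b + ind (J ℓ)) (update-other false J (ℓ≢p ∘ sym)) ⟩
                count J' + ind (J p) + ind (J ℓ)                  ≡⟨ ℕₚ.+-assoc (count J') _ _ ⟩
                count J' + (ind (J p) + ind (J ℓ))                ≤⟨ ℕₚ.+-mono-≤ (bound J' (remove-independent p (remove-independent ℓ indep-J)))
                                                                                 (at-most-one (J p) (J ℓ) λ Jp Jℓ → proj₂ indep-J ℓ p Jℓ Jp (adj⇒Adj ℓ∼p)) ⟩
                I'.α + 1                                          ≡⟨ ℕₚ.+-comm I'.α 1 ⟩
                suc I'.α                                          ∎
      where open ℕₚ.≤-Reasoning

    identities : Identities W
    identities = record
      { supp = supp ; supp-sound = supp-sound ; supp-complete = supp-complete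
      ; ν = suc I'.ν ; ν-is = ν-is ; α = suc I'.α ; α-is = α-is
      ; ν-identity = trans (pendant-ν p-sees-supp {c = count (coreIn W' S')} I'.ν-identity) (sym (cong₂ (λ c r → (c + c) + r) count-core count-rest))
      ; α-identity = trans (pendant-α p-sees-supp {s = count S'} I'.α-identity) (sym (cong₂ (λ s r → (s + s) + r) count-supp count-rest))
      }

  deepest-parent : ∀ {W : VSet n} {ℓ u} → (∀ v → W v ≡ true → depth v ≤ depth ℓ) →
                   W u ≡ true → adj ℓ u ≡ true → depth ℓ ≡ suc (depth u)
  deepest-parent {ℓ = ℓ} deepest Wu ℓ∼u with adjacent-layers (adj⇒Adj ℓ∼u)
  ... | inj₁ u-below = ⊥-elim (ℕₚ.1+n≰n (subst (_≤ depth ℓ) u-below (deepest _ Wu)))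
  ... | inj₂ ℓ-below = ℓ-below

  identities-for : ∀ k W → count W ≤ k → Identities W
  identities-for k W size with maximise W depth
  ... | inj₁ empty = identities-empty empty
  ... | inj₂ (ℓ , Wℓ , deepest) with k
  ...   | zero  = ⊥-elim (ℕₚ.n≮0 (ℕₚ.≤-trans (smaller W ℓ Wℓ) size))
  ...   | suc k with any? (λ u → (W u Boolₚ.≟ true) ×-dec (adj ℓ u Boolₚ.≟ true))
  ...     | no isolated = Isolated.identities W ℓ Wℓ (λ u Wu → ¬-not λ ℓ∼u → isolated (u , Wu , ℓ∼u))
                            (identities-for k (remove ℓ W) (ℕₚ.≤-pred (ℕₚ.≤-trans (smaller W ℓ Wℓ) size)))
  ...     | yes (p , Wp , ℓ∼p) = Pendant.identities W ℓ p Wℓ Wp ℓ∼p pendant deepest (deepest-parent deepest Wp ℓ∼p)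
                                   (identities-for k (remove p (remove ℓ W)) size')
    where
    pendant : ∀ u → W u ≡ true → adj ℓ u ≡ true → u ≡ p
    pendant u Wu ℓ∼u = unique-parent (adj⇒Adj (trans (adj-sym u ℓ) ℓ∼u)) (adj⇒Adj (trans (adj-sym p ℓ) ℓ∼p))
                                     (deepest-parent deepest Wu ℓ∼u) (deepest-parent deepest Wp ℓ∼p)
    size' : count (remove p (remove ℓ W)) ≤ k
    size' = ℕₚ.≤-trans (not-larger (remove ℓ W) p) (ℕₚ.≤-pred (ℕₚ.≤-trans (smaller W ℓ Wℓ) size))

  V : VSet n
  V _ = true

  SuppIn-V : ∀ v → InSupp G v ⇔ SuppIn V v
  SuppIn-V v = mk⇔ (λ (x , null , xv≢0) → x , ((λ u ()) , (λ u _ → null u)) , xv≢0)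
                   (λ (x , (_ , rows) , xv≢0) → x , (λ u → rows u refl) , xv≢0)

  matching-number-unique : ∀ {ν k} → IsMatchingNumber G ν → MatchingNumberIn V k → ν ≡ k
  matching-number-unique {ν} {k} ((M , matching , size) , bound) ((M' , (matching' , _) , size') , bound') =
    ℕₚ.≤-antisym (subst (_≤ k) size (bound' M (matching , All.universal (λ _ → refl) _)))
                 (subst (_≤ ν) size' (bound M' matching'))

  independence-number-unique : ∀ {α k} → IsIndependenceNumber G α → IndependenceNumberIn V k → α ≡ k
  independence-number-unique {α} {k} ((I , indep , size) , bound) ((J , (_ , indep-J) , size') , bound') =
    ℕₚ.≤-antisym (subst (_≤ k) (trans (sym (subset-count I)) size) (bound' (lookup I) ((λ _ _ → refl) , indep-I)))
                 (subst (_≤ α) (trans (subset-count (tabulate J)) (trans (count-ext (Vecₚ.lookup∘tabulate J)) size'))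
                        (bound (tabulate J) indep-T))
    where
    open Equivalence
    indep-I : ∀ u v → lookup I u ≡ true → lookup I v ≡ true → ¬ Adj G u v
    indep-I u v Iu Iv = indep u v (from (∈⇔lookup I u) Iu) (from (∈⇔lookup I v) Iv)
    indep-T : ∀ u v → u ∈ tabulate J → v ∈ tabulate J → ¬ Adj G u v
    indep-T u v u∈ v∈ = indep-J u v (trans (sym (Vecₚ.lookup∘tabulate J u)) (to (∈⇔lookup _ u) u∈))
                                    (trans (sym (Vecₚ.lookup∘tabulate J v)) (to (∈⇔lookup _ v) v∈))

  theorem : (S C : Subset n) → (∀ v → (v ∈ S) ⇔ InSupp G v) → (∀ v → (v ∈ C) ⇔ InCore G v) →
            (ν α : ℕ) → IsMatchingNumber G ν → IsIndependenceNumber G α →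
            (2 * ν ≡ 2 * ∣ C ∣ + ∣ ∁ (S ∪ C) ∣) × (2 * α ≡ 2 * ∣ S ∣ + ∣ ∁ (S ∪ C) ∣)
  theorem S C S-is C-is ν α ν-is α-is =
    doubled (matching-number-unique ν-is R.ν-is) R.ν-identity (size C C-agrees) (size (∁ (S ∪ C)) rest-agrees) ,
    doubled (independence-number-unique α-is R.α-is) R.α-identity (size S S-agrees) (size (∁ (S ∪ C)) rest-agrees)
    where
    open Equivalence
    R = identities-for (count V) V ℕₚ.≤-refl
    module R = Identities R
    size : ∀ (P : Subset n) {b : VSet n} → (∀ v → lookup P v ≡ b v) → ∣ P ∣ ≡ count b
    size P agree = trans (subset-count P) (count-ext agree)
    S-agrees : ∀ v → lookup S v ≡ R.supp v
    S-agrees = lookup-agrees S R.supp S-is (λ v Sv → from (SuppIn-V v) (R.supp-sound v Sv))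
                                           (λ v sv → R.supp-complete v (to (SuppIn-V v) sv))
    C-agrees : ∀ v → lookup C v ≡ coreIn V R.supp v
    C-agrees = lookup-agrees C (coreIn V R.supp) C-is
      (λ v Cv → let u , Su∧u∼v = anyᵇ-elim {f = λ u → R.supp u ∧ adj u v} Cv
                in u , from (SuppIn-V u) (R.supp-sound u (Boolₚ.∧-conicalˡ _ _ Su∧u∼v)) , adj⇒Adj (Boolₚ.∧-conicalʳ _ _ Su∧u∼v))
      (λ v (u , su , u∼v) → anyᵇ-intro u (cong₂ _∧_ (R.supp-complete u (to (SuppIn-V u) su)) (Adj⇒adj u∼v)))
    rest-agrees : ∀ v → lookup (∁ (S ∪ C)) v ≡ restIn V R.supp v
    rest-agrees v = begin
      lookup (∁ (S ∪ C)) v                 ≡⟨ Vecₚ.lookup-map v not (S ∪ C) ⟩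
      not (lookup (S ∪ C) v)               ≡⟨ cong not (Vecₚ.lookup-zipWith _∨_ v S C) ⟩
      not (lookup S v ∨ lookup C v)        ≡⟨ deMorgan₂ (lookup S v) (lookup C v) ⟩
      not (lookup S v) ∧ not (lookup C v)  ≡⟨ cong₂ (λ s c → not s ∧ not c) (S-agrees v) (C-agrees v) ⟩
      restIn V R.supp v                    ∎
      where open ≡-Reasoning

-- A tree is layered by depth from any vertex (here vertex 0), so the theorem
-- for layered graphs applies.
mainTheorem5 : (n : ℕ) (G : Graph n) → IsTree G →
    (S C : Subset n) → (∀ v → (v ∈ S) ⇔ InSupp G v) → (∀ v → (v ∈ C) ⇔ InCore G v) →
    (ν α : ℕ) → IsMatchingNumber G ν → IsIndependenceNumber G α →
    (2 * ν ≡ 2 * ∣ C ∣ + ∣ ∁ (S ∪ C) ∣) × (2 * α ≡ 2 * ∣ S ∣ + ∣ ∁ (S ∪ C) ∣)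
mainTheorem5 zero    G (() , _)
mainTheorem5 (suc m) G (_ , connected , acyclic) = Layered.theorem G (TreeDepth.layering G zero connected acyclic)
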